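{- Let $\mathcal R\subset\mathbb{Z}^k$ be a polyhedral region and $n$ a positive integer. Then $\mathcal R$ can be written as the union of a set of measure zero and a polyhedral region $\mathcal R'$ such that every $\mathbf z\in\mathcal R'$ lies in a $k$-dimensional box of size $n$ contained entirely in $\mathcal R$.
   Context: A hyperplane in $\mathbb{Z}^k$ is $\{\mathbf z:\mathbf v\cdot\mathbf z=m\}$ and a half-space is $\{\mathbf z:\mathbf v\cdot\mathbf z>m\}$, with $\mathbf v\in\mathbb{Z}^k$, $m\in\mathbb{Z}$. A region is polyhedral if it equals $\mathbb{Z}^k$ or is a finite intersection of half-spaces. A set of measure zero is a subset of $\mathbb{Z}^k$ covered by finitely many hyperplanes. A $k$-dimensional box of size $n$ is $\{\mathbf z\in\mathbb{Z}^k: c_i\le z_i\le c_i+n,\ i=1,\ldots,k\}$ with $c_i\in\mathbb{Z}$. -}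

module Defs where

open import Data.Nat using (ℕ)
open import Data.Integer using (ℤ; +_; _+_; _*_; _≤_; _<_)
open import Data.Fin using (Fin; zero; suc)
open import Data.Product using (_×_; Σ; ∃; _,_)
open import Data.List using (List)
open import Data.List.Relation.Unary.All using (All)
open import Data.List.Relation.Unary.Any using (Any)
open import Relation.Binary.PropositionalEquality using (_≡_)
open import Relation.Nullary using (¬_)

Point : ℕ → Set
Point k = Fin k → ℤ

dot : ∀ {k} → Point k → Point k → ℤ
dot {ℕ.zero} v z = + 0
dot {ℕ.suc k} v z = v zero * z zero + dot (λ i → v (suc i)) (λ i → z (suc i))

record Linear (k : ℕ) : Set where
  constructor lin
  field
    vec : Point k
    off : ℤ
open Linear public

InHalfSpace : ∀ {k} → Linear k → Point k → Set
InHalfSpace h z = off h < dot (vec h) z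

OnHyperplane : ∀ {k} → Linear k → Point k → Set
OnHyperplane h z = dot (vec h) z ≡ off h

NonZeroVec : ∀ {k} → Point k → Set
NonZeroVec v = ¬ (∀ i → v i ≡ + 0)

-- A polyhedral region is described by a finite list of half-spaces; the
-- empty list describes ℤ^k itself.
InPolyhedral : ∀ {k} → List (Linear k) → Point k → Set
InPolyhedral hs z = All (λ h → InHalfSpace h z) hs

-- z is covered by the finitely many (proper, v ≠ 0) hyperplanes in the list
Covered : ∀ {k} → List (Linear k) → Point k → Set
Covered ps z = Any (λ p → OnHyperplane p z) ps

InBox : ∀ {k} → ℕ → Point k → Point k → Set
InBox n c z = ∀ i → (c i ≤ z i) × (z i ≤ c i + + n)

-- Replace each half-space v · z > m of R by the thinner half-space
-- v · z > m + n‖v‖₁.  A box of size n with corner c only contains points w with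
-- v · w ≥ v · c − n‖v‖₁, so the box at any point of the thinner region stays
-- inside R; and a point of R that misses the thinner half-space satisfies
-- m < v · z ≤ m + n‖v‖₁, hence lies on one of the n‖v‖₁ hyperplanes
-- v · z = m + j, which are proper because n‖v‖₁ > 0 forces v ≠ 0.
module Submission where

open import Defs
open import Data.Nat as ℕ using (ℕ; zero; suc; _≥_)
import Data.Nat.Properties as ℕ
open import Data.Integer as ℤ using (ℤ; +_; -[1+_]; _+_; _*_; -_; ∣_∣; _≤_; _<_; +≤+)
open import Data.Integer.Properties
open import Data.Integer.Tactic.RingSolver using (solve-∀)
import Data.Fin as Fin
open import Data.Vec.Functional using (head; tail)
open import Data.Product using (_×_; Σ; _,_; proj₁; proj₂)
open import Data.Sum as Sum using (_⊎_; inj₁; inj₂)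
open import Data.List using (List; []; _∷_; map; concatMap)
open import Data.List.Relation.Unary.All as All using (All; []; _∷_)
open import Data.List.Relation.Unary.All.Properties using (map⁺; map⁻; concat⁺)
open import Data.List.Relation.Unary.Any using (Any; here; there)
open import Data.List.Relation.Unary.Any.Properties using (concatMap⁺)
open import Function using (_∘_)
open import Relation.Binary.PropositionalEquality using (_≡_; refl; sym; trans; cong; subst)
open import Relation.Nullary using (yes; no)
open import Data.Empty using (⊥-elim)

All-⊎⇒Any⊎All : ∀ {a p q} {A : Set a} {P : A → Set p} {Q : A → Set q} {xs : List A} →
  All (λ x → P x ⊎ Q x) xs → Any P xs ⊎ All Q xs
All-⊎⇒Any⊎All []             = inj₂ []
All-⊎⇒Any⊎All (inj₁ p ∷ _)   = inj₁ (here p)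
All-⊎⇒Any⊎All (inj₂ q ∷ pqs) = Sum.map there (q ∷_) (All-⊎⇒Any⊎All pqs)

+-cancelʳ-< : ∀ i j k → i + k < j + k → i < j
+-cancelʳ-< i j k i+k<j+k with i ℤ.<? j
... | yes i<j = i<j
... | no  i≮j = ⊥-elim (<⇒≱ i+k<j+k (+-monoˡ-≤ k (≮⇒≥ i≮j)))

‖_‖₁ : ∀ {k} → Point k → ℕ
‖_‖₁ {zero}  v = 0
‖_‖₁ {suc k} v = ∣ head v ∣ ℕ.+ ‖ tail v ‖₁

‖‖₁-zero : ∀ {k} (v : Point k) → (∀ i → v i ≡ + 0) → ‖ v ‖₁ ≡ 0
‖‖₁-zero {zero}  v v≡0 = refl
‖‖₁-zero {suc k} v v≡0 rewrite v≡0 Fin.zero = ‖‖₁-zero (tail v) (v≡0 ∘ Fin.suc)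

*-≤-onInterval : ∀ a {c w} n → c ≤ w → w ≤ c + + n → a * c ≤ a * w + + (n ℕ.* ∣ a ∣)
*-≤-onInterval (+ m) {w = w} n c≤w _ =
  ≤-trans (*-monoˡ-≤-nonNeg (+ m) c≤w) (i≤i+j (+ m * w) (+ (n ℕ.* m)))
*-≤-onInterval a@(-[1+ m ]) {c} {w} n _ w≤c+n = begin
  a * c                           ≡⟨ shift-by-width ⟩
  a * (c + + n) + + (n ℕ.* suc m) ≤⟨ +-monoˡ-≤ (+ (n ℕ.* suc m)) (*-monoˡ-≤-nonPos a w≤c+n) ⟩
  a * w + + (n ℕ.* suc m)         ∎
  where
  open ≤-Reasoning
  negate-identity : ∀ b c n → (- b) * c ≡ (- b) * (c + n) + n * b
  negate-identity = solve-∀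
  shift-by-width : a * c ≡ a * (c + + n) + + (n ℕ.* suc m)
  shift-by-width = trans (negate-identity (+ suc m) c (+ n))
                         (cong (λ t → a * (c + + n) + t) (sym (pos-* n (suc m))))

dot-≤-onBox : ∀ {k} n (v c w : Point k) → InBox n c w → dot v c ≤ dot v w + + (n ℕ.* ‖ v ‖₁)
dot-≤-onBox {zero}  n v c w _ = +≤+ ℕ.z≤n
dot-≤-onBox {suc k} n v c w c≤w≤c+n = begin
  head v * head c + dot (tail v) (tail c)
    ≤⟨ +-mono-≤ (*-≤-onInterval (head v) n (proj₁ (c≤w≤c+n Fin.zero)) (proj₂ (c≤w≤c+n Fin.zero)))
                (dot-≤-onBox n (tail v) (tail c) (tail w) (c≤w≤c+n ∘ Fin.suc)) ⟩
  (head v * head w + + (n ℕ.* ∣ head v ∣)) + (dot (tail v) (tail w) + + (n ℕ.* ‖ tail v ‖₁))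
    ≡⟨ interchange (head v * head w) (+ (n ℕ.* ∣ head v ∣)) (dot (tail v) (tail w)) _ ⟩
  (head v * head w + dot (tail v) (tail w)) + (+ (n ℕ.* ∣ head v ∣) + + (n ℕ.* ‖ tail v ‖₁))
    ≡⟨ cong (λ t → dot v w + t) width-sum ⟩
  dot v w + + (n ℕ.* ‖ v ‖₁) ∎
  where
  open ≤-Reasoning
  interchange : ∀ p q r s → (p + q) + (r + s) ≡ (p + r) + (q + s)
  interchange = solve-∀
  width-sum : + (n ℕ.* ∣ head v ∣) + + (n ℕ.* ‖ tail v ‖₁) ≡ + (n ℕ.* ‖ v ‖₁)
  width-sum = trans (sym (pos-+ (n ℕ.* ∣ head v ∣) _))
                    (cong +_ (sym (ℕ.*-distribˡ-+ n ∣ head v ∣ ‖ tail v ‖₁)))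

corner-∈Box : ∀ {k} n (c : Point k) → InBox n c c
corner-∈Box n c i = ≤-refl , i≤i+j (c i) (+ n)

gapHyperplanes : ∀ {k} → Point k → ℤ → ℕ → List (Linear k)
gapHyperplanes v m zero    = []
gapHyperplanes v m (suc b) = lin v (m + + suc b) ∷ gapHyperplanes v m b

gapHyperplanes-cover : ∀ {k} (v z : Point k) m b →
  m < dot v z → dot v z ≤ m + + b → Covered (gapHyperplanes v m b) z
gapHyperplanes-cover v z m zero m<v·z v·z≤m =
  ⊥-elim (<⇒≱ m<v·z (≤-trans v·z≤m (≤-reflexive (+-identityʳ m))))
gapHyperplanes-cover v z m (suc b) m<v·z v·z≤m+b+1 with dot v z ℤ.≟ m + + suc b
... | yes v·z≡m+b+1 = here v·z≡m+b+1
... | no  v·z≢m+b+1 = there (gapHyperplanes-cover v z m b m<v·z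
        (≤-trans (i<j⇒i≤pred[j] (≤∧≢⇒< v·z≤m+b+1 v·z≢m+b+1)) (≤-reflexive (sym (+-pred m (+ suc b))))))

gapHyperplanes-nonZero : ∀ {k} (v : Point k) m b →
  (ℕ.NonZero b → NonZeroVec v) → All (NonZeroVec ∘ vec) (gapHyperplanes v m b)
gapHyperplanes-nonZero v m zero    _  = []
gapHyperplanes-nonZero v m (suc b) nz = nz _ ∷ gapHyperplanes-nonZero v m b (λ _ → nz _)

margin : ∀ {k} → ℕ → Linear k → ℕ
margin n h = n ℕ.* ‖ vec h ‖₁

margin-nonZero⇒nonZeroVec : ∀ {k} n (h : Linear k) → ℕ.NonZero (margin n h) → NonZeroVec (vec h)
margin-nonZero⇒nonZeroVec n h nz v≡0 =
  ℕ.≢-nonZero⁻¹ _ {{subst ℕ.NonZero (cong (n ℕ.*_) (‖‖₁-zero (vec h) v≡0)) nz}} (ℕ.*-zeroʳ n)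

thin : ∀ {k} → ℕ → Linear k → Linear k
thin n h = lin (vec h) (off h + + margin n h)

gap : ∀ {k} → ℕ → Linear k → List (Linear k)
gap n h = gapHyperplanes (vec h) (off h) (margin n h)

thin⊆ : ∀ {k} n (h : Linear k) z → InHalfSpace (thin n h) z → InHalfSpace h z
thin⊆ n h z = ≤-<-trans (i≤i+j (off h) (+ margin n h))

halfSpace-split : ∀ {k} n (h : Linear k) z →
  InHalfSpace h z → Covered (gap n h) z ⊎ InHalfSpace (thin n h) z
halfSpace-split n h z z∈h with off h + + margin n h ℤ.<? dot (vec h) z
... | yes z∈thin = inj₂ z∈thin
... | no  z∉thin = inj₁ (gapHyperplanes-cover (vec h) z (off h) (margin n h) z∈h (≮⇒≥ z∉thin))

thin-box⊆ : ∀ {k} n (h : Linear k) c w → InHalfSpace (thin n h) c → InBox n c w → InHalfSpace h w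
thin-box⊆ n h c w c∈thin w∈box =
  +-cancelʳ-< (off h) (dot (vec h) w) (+ margin n h) (<-≤-trans c∈thin (dot-≤-onBox n (vec h) c w w∈box))

gap-nonZero : ∀ {k} n (h : Linear k) → All (NonZeroVec ∘ vec) (gap n h)
gap-nonZero n h = gapHyperplanes-nonZero (vec h) (off h) (margin n h) (margin-nonZero⇒nonZeroVec n h)

mainTheorem17 : (k : ℕ) (R : List (Linear k)) (n : ℕ) → n ≥ 1 →
    Σ (List (Linear k)) λ N → Σ (List (Linear k)) λ R′ →
      All (λ p → NonZeroVec (vec p)) N
      × (∀ z → InPolyhedral R′ z → InPolyhedral R z)
      × (∀ z → InPolyhedral R z → Covered N z ⊎ InPolyhedral R′ z)
      × (∀ z → InPolyhedral R′ z →
           Σ (Point k) λ c → InBox n c z × (∀ w → InBox n c w → InPolyhedral R w))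
mainTheorem17 k R n _ =
  concatMap (gap n) R , map (thin n) R ,
  concat⁺ (map⁺ (All.universal (gap-nonZero n) R)) ,
  (λ z z∈R′ → All.map (thin⊆ n _ z) (map⁻ z∈R′)) ,
  (λ z z∈R → Sum.map (concatMap⁺ (gap n)) map⁺ (All-⊎⇒Any⊎All (All.map (halfSpace-split n _ z) z∈R))) ,
  (λ z z∈R′ → z , corner-∈Box n z ,
     λ w w∈box → All.map (λ z∈thin → thin-box⊆ n _ z w z∈thin w∈box) (map⁻ z∈R′))
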